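{- Let $M$ be a loopless matroid on a finite set $E$ with rank function $r$. Suppose $S' \subseteq S \subseteq E$, and let $\mathbf{P}'$, $\mathbf{P}$ be partitions of $S'$, $S$ respectively such that $\mathbf{P}' = \mathbf{P}\wedge\{S'\} = \{P\cap S' : P \in \mathbf{P}\}\setminus\{\emptyset\}$. Then: (1) $\tilde r(\mathbf{P}) = r'(S) = r'(S')$ if and only if $r(P\cap S') = r(P)$ for all $P\in\mathbf{P}$ and $\mathbf{P}'$ is optimal for $S'$; (2) if $\tilde r(\mathbf{P}) = r'(S) = r'(S')$, then $\mathbf{P}$ is the coarsest optimal partition of $S$ if and only if $\mathbf{P}'$ is the coarsest optimal partition of $S'$.
   Context: A partition of a finite set $S$ is a set of pairwise disjoint nonempty subsets of $S$ with union $S$. For a partition $\mathbf{P}$, $\tilde r(\mathbf{P}) := \sum_{P\in\mathbf{P}}(2r(P)-1)$; $r'(S) := \min\{\tilde r(\mathbf{P}) : \mathbf{P}$ a partition of $S\}$; $\mathbf{P}$ is optimal for $S$ if $\tilde r(\mathbf{P}) = r'(S)$. A partition $\mathbf{Q}$ refines $\mathbf{R}$ (and $\mathbf{R}$ is coarser) if every part of $\mathbf{Q}$ lies in a part of $\mathbf{R}$. The coarsest optimal partition of $S$ is the (unique) optimal partition of $S$ of which every optimal partition of $S$ is a refinement; such a partition always exists. -}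

module Defs where

open import Data.Nat using (ℕ; _+_; _*_; _∸_; _≤_)
open import Data.Fin using (Fin)
open import Data.Fin.Subset using (Subset; _⊆_; _∩_; _∪_; ⁅_⁆; ∣_∣; Nonempty; ⊥)
open import Data.List using (List; map; foldr)
open import Data.Nat.ListAction using (sum)
open import Data.List.Membership.Propositional using () renaming (_∈_ to _∈ₗ_)
open import Data.List.Relation.Unary.All using (All)
open import Data.List.Relation.Unary.AllPairs using (AllPairs)
open import Data.Product using (Σ; _×_; ∃; ∃-syntax)
open import Relation.Binary.PropositionalEquality using (_≡_)

record Matroid (n : ℕ) : Set where
  field
    r           : Subset n → ℕ
    r-bounded   : ∀ X → r X ≤ ∣ X ∣
    r-monotone  : ∀ {X Y} → X ⊆ Y → r X ≤ r Y
    r-submod    : ∀ X Y → r (X ∪ Y) + r (X ∩ Y) ≤ r X + r Y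

Loopless : ∀ {n} → Matroid n → Set
Loopless {n} M = ∀ (e : Fin n) → Matroid.r M ⁅ e ⁆ ≡ 1

Family : ℕ → Set
Family n = List (Subset n)

-- Partition of S: parts nonempty, pairwise disjoint (over distinct list
-- positions, which also rules out repeated parts), with union S.
IsPartition : ∀ {n} → Subset n → Family n → Set
IsPartition S 𝐏 =
  All Nonempty 𝐏 × AllPairs (λ A B → A ∩ B ≡ ⊥) 𝐏 × foldr _∪_ ⊥ 𝐏 ≡ S

-- r̃(P) = Σ_{P ∈ 𝐏} (2 r(P) - 1)   (r(P) ≥ 1 for nonempty P in a loopless matroid)
r̃ : ∀ {n} → Matroid n → Family n → ℕ
r̃ M 𝐏 = sum (map (λ P → 2 * Matroid.r M P ∸ 1) 𝐏)

-- "r'(S) = k": k is the minimum of r̃ over all partitions of S.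
IsR' : ∀ {n} → Matroid n → Subset n → ℕ → Set
IsR' M S k =
  (∃[ 𝐐 ] (IsPartition S 𝐐 × r̃ M 𝐐 ≡ k)) ×
  (∀ 𝐐 → IsPartition S 𝐐 → k ≤ r̃ M 𝐐)

Optimal : ∀ {n} → Matroid n → Subset n → Family n → Set
Optimal M S 𝐏 = IsPartition S 𝐏 × IsR' M S (r̃ M 𝐏)

Refines : ∀ {n} → Family n → Family n → Set
Refines 𝐐 𝐑 = ∀ {Q} → Q ∈ₗ 𝐐 → ∃[ R ] (R ∈ₗ 𝐑 × Q ⊆ R)

CoarsestOptimal : ∀ {n} → Matroid n → Subset n → Family n → Set
CoarsestOptimal M S 𝐏 =
  Optimal M S 𝐏 × (∀ 𝐐 → Optimal M S 𝐐 → Refines 𝐐 𝐏)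

-- 𝐏' = 𝐏 ∧ {S'} = {P ∩ S' : P ∈ 𝐏} ∖ {∅}, as an equality of sets of subsets.
IsMeet : ∀ {n} → Family n → Subset n → Family n → Set
IsMeet 𝐏 S' 𝐏' =
  (∀ {X} → X ∈ₗ 𝐏' → ∃[ P ] (P ∈ₗ 𝐏 × X ≡ P ∩ S' × Nonempty X)) ×
  (∀ {P} → P ∈ₗ 𝐏 → Nonempty (P ∩ S') → (P ∩ S') ∈ₗ 𝐏')

{-# OPTIONS --safe #-}
module Submission where

-- Intersecting the parts of a partition of S with S' ⊆ S (and dropping empty traces) gives a
-- partition of S' and, r being monotone, never increases r̃; so r'(S') ≤ r'(S), and r̃(𝐏 ∧ {S'})
-- = r̃(𝐏) exactly when r(P ∩ S') = r(P) for all parts, which is (1).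
-- For (2) the key is uncrossing. Let X be a part of an optimal partition 𝐐 of T ⊆ S. Merge X with
-- all parts of 𝐏 that meet it, and split X along 𝐏 inside 𝐐: by submodularity this does not
-- increase r̃(𝐏) + r̃(𝐐), and since 𝐐 is optimal the merged partition is again optimal for S.
-- A coarsest 𝐏 therefore swallows X. Conversely, a coarsest 𝐏' swallows the trace on S' of the
-- merged part, and as every part of 𝐏 meets S' this forces X into a single part of 𝐏.

open import Defs
import Algebra.Properties.CommutativeSemigroup as CommutativeSemigroupProperties
open import Data.Empty using () renaming (⊥ to False)
open import Data.Fin using (Fin)
open import Data.Fin.Subset using (Subset; _⊆_; _∩_; _∪_; ∣_∣; Nonempty; Empty; ⊥; _∈_)
open import Data.Fin.Subset.Properties
  using (nonempty?; Empty-unique; ∉⊥; ∣⊥∣≡0; x∈⁅y⁆⇒x≡y; ⊆-antisym; x∈p∩q⁺; x∈p∩q⁻; x∈p∪q⁺; x∈p∪q⁻; p∩q⊆p; p∩q⊆q; ∪-assoc; ∪-comm; ∪-identityʳ)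
open import Data.List using (List; []; _∷_; map; foldr; filter; _++_)
open import Data.List.Properties using (map-∘; map-cong-local; map-++)
open import Data.List.Membership.Propositional using () renaming (_∈_ to _∈ₗ_)
open import Data.List.Membership.Propositional.Properties using (∈-map⁺; ∈-map⁻; ∈-filter⁺; ∈-filter⁻; ∈-++⁺ˡ; ∈-++⁺ʳ; ∈-++⁻)
open import Data.List.Membership.Propositional.Properties.WithK using (unique∧set⇒bag)
open import Data.List.Relation.Binary.BagAndSetEquality using (∼bag⇒↭)
open import Data.List.Relation.Binary.Permutation.Propositional using (_↭_)
import Data.List.Relation.Binary.Permutation.Propositional.Properties as ↭
open import Data.List.Relation.Unary.All as All using (All; []; _∷_)
import Data.List.Relation.Unary.All.Properties as AllP
open import Data.List.Relation.Unary.AllPairs as AllPairs using (AllPairs; []; _∷_)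
import Data.List.Relation.Unary.AllPairs.Properties as AllPairsP
open import Data.List.Relation.Unary.Any using (here; there)
open import Data.List.Relation.Unary.Unique.Propositional using (Unique)
open import Data.Nat using (ℕ; suc; _+_; _*_; _∸_; _≤_; z≤n; s≤s⁻¹)
open import Data.Nat.Properties
open import Data.Nat.ListAction using (sum)
open import Data.Nat.ListAction.Properties using (sum-++; sum-↭)
open import Data.Nat.Tactic.RingSolver using (solve-∀)
open import Data.Product using (_×_; _,_; proj₁; proj₂; ∃-syntax)
open import Data.Sum using (inj₁; inj₂)
open import Function.Bundles using (_⇔_; mk⇔)
open import Relation.Nullary using (¬_; yes; no; contradiction)
open import Relation.Unary using (Pred; Decidable)
open import Relation.Unary.Properties using (∁?)
open import Relation.Binary.PropositionalEquality

open CommutativeSemigroupProperties +-commutativeSemigroup using (x∙yz≈y∙xz; xy∙z≈y∙xz)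

private variable
  n : ℕ
  x : Fin n
  A B P R U X S S' T : Subset n
  L Q 𝐏 : Family n

module _ {a} {I : Set a} where

  sum-map-mono-≤ : {f g : I → ℕ} → (∀ i → f i ≤ g i) →
                   ∀ is → sum (map f is) ≤ sum (map g is)
  sum-map-mono-≤ f≤g []       = z≤n
  sum-map-mono-≤ f≤g (i ∷ is) = +-mono-≤ (f≤g i) (sum-map-mono-≤ f≤g is)

  sum-map-mono-≤-rigid : {f g : I → ℕ} → (∀ i → f i ≤ g i) →
                         ∀ is → sum (map g is) ≤ sum (map f is) → All (λ i → f i ≡ g i) is
  sum-map-mono-≤-rigid f≤g []       _   = []
  sum-map-mono-≤-rigid {f} {g} f≤g (i ∷ is) g≤f =
    ≤-antisym (f≤g i) gi≤fi ∷ sum-map-mono-≤-rigid f≤g is Σg≤Σf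
    where
    gi≤fi : g i ≤ f i
    gi≤fi = +-cancelʳ-≤ _ _ _ (≤-trans g≤f (+-monoʳ-≤ (f i) (sum-map-mono-≤ f≤g is)))
    Σg≤Σf : sum (map g is) ≤ sum (map f is)
    Σg≤Σf = +-cancelˡ-≤ (g i) _ _ (≤-trans g≤f (+-monoˡ-≤ _ (f≤g i)))

  sum-map-filter : ∀ {p} {Q : Pred I p} (Q? : Decidable Q) {f : I → ℕ} →
                   (∀ {i} → ¬ Q i → f i ≡ 0) → ∀ is → sum (map f (filter Q? is)) ≡ sum (map f is)
  sum-map-filter Q?     f≡0 []       = refl
  sum-map-filter Q? {f} f≡0 (i ∷ is) with Q? i
  ... | yes _  = cong (f i +_) (sum-map-filter Q? f≡0 is)
  ... | no ¬Qi = trans (sum-map-filter Q? f≡0 is) (cong (_+ sum (map f is)) (sym (f≡0 ¬Qi)))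

  sum-map-filter-split : ∀ {p} {Q : Pred I p} (Q? : Decidable Q) (f : I → ℕ) → ∀ is →
    sum (map f is) ≡ sum (map f (filter Q? is)) + sum (map f (filter (∁? Q?) is))
  sum-map-filter-split Q? f []       = refl
  sum-map-filter-split Q? f (i ∷ is) with Q? i
  ... | yes _ = trans (cong (f i +_) (sum-map-filter-split Q? f is)) (sym (+-assoc (f i) _ _))
  ... | no _  = trans (cong (f i +_) (sum-map-filter-split Q? f is))
                      (x∙yz≈y∙xz (f i) (sum (map f (filter Q? is))) _)

  ∈⇒≤sum-map : (f : I → ℕ) {i : I} {is : List I} → i ∈ₗ is → f i ≤ sum (map f is)
  ∈⇒≤sum-map f (here refl)              = m≤m+n _ _
  ∈⇒≤sum-map f {is = j ∷ _} (there i∈) = ≤-trans (∈⇒≤sum-map f i∈) (m≤n+m _ (f j))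

Disjoint : Subset n → Subset n → Set
Disjoint A B = A ∩ B ≡ ⊥

nonempty-∩ : x ∈ A → x ∈ B → Nonempty (A ∩ B)
nonempty-∩ x∈A x∈B = _ , x∈p∩q⁺ (x∈A , x∈B)

nonempty-⊆ : A ⊆ B → Nonempty A → Nonempty B
nonempty-⊆ A⊆B (_ , x∈A) = _ , A⊆B x∈A

disjoint⁻ : Disjoint A B → x ∈ A → x ∈ B → False
disjoint⁻ A∩B≡⊥ x∈A x∈B = ∉⊥ (subst (_ ∈_) A∩B≡⊥ (x∈p∩q⁺ (x∈A , x∈B)))

disjoint⁺ : (∀ {x} → x ∈ A → x ∈ B → False) → Disjoint A B
disjoint⁺ {A = A} {B} disj = Empty-unique λ (_ , x∈A∩B) →
  let (x∈A , x∈B) = x∈p∩q⁻ A B x∈A∩B in disj x∈A x∈B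

⋃ : Family n → Subset n
⋃ = foldr _∪_ ⊥

∈⋃⁻ : ∀ L → x ∈ ⋃ L → ∃[ A ] (A ∈ₗ L × x ∈ A)
∈⋃⁻ [] x∈⊥ = contradiction x∈⊥ ∉⊥
∈⋃⁻ (A ∷ L) x∈⋃ with x∈p∪q⁻ A (⋃ L) x∈⋃
... | inj₁ x∈A = A , here refl , x∈A
... | inj₂ x∈⋃L = let (B , B∈L , x∈B) = ∈⋃⁻ L x∈⋃L in B , there B∈L , x∈B

∈⋃⁺ : A ∈ₗ L → x ∈ A → x ∈ ⋃ L
∈⋃⁺ (here refl) x∈A = x∈p∪q⁺ (inj₁ x∈A)
∈⋃⁺ (there A∈L) x∈A = x∈p∪q⁺ (inj₂ (∈⋃⁺ A∈L x∈A))

isPartition⁺ : All Nonempty L → AllPairs Disjoint L → (∀ {A} → A ∈ₗ L → A ⊆ S) →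
               (∀ {x} → x ∈ S → ∃[ A ] (A ∈ₗ L × x ∈ A)) → IsPartition S L
isPartition⁺ {L = L} nonempty disjoint ⊆S cover = nonempty , disjoint , ⊆-antisym
  (λ x∈⋃ → let (A , A∈L , x∈A) = ∈⋃⁻ L x∈⋃ in ⊆S A∈L x∈A)
  (λ x∈S → let (A , A∈L , x∈A) = cover x∈S in ∈⋃⁺ A∈L x∈A)

part⊆ : IsPartition S L → A ∈ₗ L → A ⊆ S
part⊆ (_ , _ , ⋃L≡S) A∈L x∈A = subst (_ ∈_) ⋃L≡S (∈⋃⁺ A∈L x∈A)

part-cover : IsPartition S L → x ∈ S → ∃[ A ] (A ∈ₗ L × x ∈ A)
part-cover {L = L} (_ , _ , ⋃L≡S) x∈S = ∈⋃⁻ L (subst (_ ∈_) (sym ⋃L≡S) x∈S)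

part-≡ : IsPartition S L → A ∈ₗ L → B ∈ₗ L → x ∈ A → x ∈ B → A ≡ B
part-≡ (_ , disjoint , _) = overlap⇒≡ disjoint
  where
  overlap⇒≡ : AllPairs Disjoint L → A ∈ₗ L → B ∈ₗ L → x ∈ A → x ∈ B → A ≡ B
  overlap⇒≡ (_ ∷ _)  (here refl) (here refl) _   _   = refl
  overlap⇒≡ (d ∷ _)  (here refl) (there B∈) x∈A x∈B = contradiction x∈B (disjoint⁻ (All.lookup d B∈) x∈A)
  overlap⇒≡ (d ∷ _)  (there A∈) (here refl) x∈A x∈B = contradiction x∈A (disjoint⁻ (All.lookup d A∈) x∈B)
  overlap⇒≡ (_ ∷ ds) (there A∈) (there B∈)  x∈A x∈B = overlap⇒≡ ds A∈ B∈ x∈A x∈B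

part-unique : IsPartition S L → Unique L
part-unique (nonempty , disjoint , _) = distinct nonempty disjoint
  where
  distinct : All Nonempty L → AllPairs Disjoint L → Unique L
  distinct []                 []         = []
  distinct ((_ , x∈A) ∷ nes) (A#L ∷ ds) =
    All.map (λ { A#B refl → disjoint⁻ A#B x∈A x∈A }) A#L ∷ distinct nes ds

meets? : (X : Subset n) → Decidable (λ P → Nonempty (P ∩ X))
meets? X P = nonempty? (P ∩ X)

hits misses restrict : Subset n → Family n → Family n
hits X = filter (meets? X)
misses X = filter (∁? (meets? X))
restrict X L = map (_∩ X) (hits X L)

restrict-isMeet : ∀ X L → IsMeet L X (restrict {n} X L)
restrict-isMeet X L = ∈restrict⁻ , λ P∈L P∩X≢∅ → ∈-map⁺ (_∩ X) (∈-filter⁺ (meets? X) P∈L P∩X≢∅)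
  where
  ∈restrict⁻ : ∀ {Y} → Y ∈ₗ restrict X L → ∃[ P ] (P ∈ₗ L × Y ≡ P ∩ X × Nonempty Y)
  ∈restrict⁻ Y∈ with ∈-map⁻ (_∩ X) Y∈
  ... | P , P∈hits , refl = P , proj₁ (∈-filter⁻ (meets? X) {xs = L} P∈hits) , refl
                              , proj₂ (∈-filter⁻ (meets? X) {xs = L} P∈hits)

restrict-isPartition : X ⊆ S → IsPartition S L → IsPartition X (restrict X L)
restrict-isPartition {X = X} {L = L} X⊆S p@(_ , disjoint , _) = isPartition⁺
  (AllP.map⁺ (AllP.all-filter (meets? X) L))
  (AllPairsP.map⁺ (AllPairsP.filter⁺ (meets? X) (AllPairs.map trace-disjoint disjoint)))
  ⊆X cover
  where
  trace-disjoint : Disjoint A B → Disjoint (A ∩ X) (B ∩ X)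
  trace-disjoint A#B = disjoint⁺ λ x∈A∩X x∈B∩X → disjoint⁻ A#B (p∩q⊆p _ X x∈A∩X) (p∩q⊆p _ X x∈B∩X)
  ⊆X : ∀ {Y} → Y ∈ₗ restrict X L → Y ⊆ X
  ⊆X Y∈ with proj₁ (restrict-isMeet X L) Y∈
  ... | P , _ , refl , _ = p∩q⊆q P X
  cover : ∀ {x} → x ∈ X → ∃[ Y ] (Y ∈ₗ restrict X L × x ∈ Y)
  cover x∈X with part-cover p (X⊆S x∈X)
  ... | P , P∈L , x∈P = P ∩ X , proj₂ (restrict-isMeet X L) P∈L (nonempty-∩ x∈P x∈X) , x∈p∩q⁺ (x∈P , x∈X)

meets-partition⇒↭ : IsPartition S L → IsPartition S Q → IsMeet 𝐏 S L → IsMeet 𝐏 S Q → L ↭ Q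
meets-partition⇒↭ pL pQ meetL meetQ =
  ∼bag⇒↭ (unique∧set⇒bag (part-unique pL) (part-unique pQ) (mk⇔ (transfer meetL meetQ) (transfer meetQ meetL)))
  where
  transfer : IsMeet 𝐏 S L → IsMeet 𝐏 S Q → ∀ {Y} → Y ∈ₗ L → Y ∈ₗ Q
  transfer (⊆meet , _) (_ , meet⊆) Y∈L with ⊆meet Y∈L
  ... | P , P∈𝐏 , refl , P∩S≢∅ = meet⊆ P∈𝐏 P∩S≢∅

merge : Subset n → Family n → Family n
merge X L = (X ∪ ⋃ (hits X L)) ∷ misses X L

⊆-merged : X ⊆ X ∪ ⋃ (hits X L)
⊆-merged x∈X = x∈p∪q⁺ (inj₁ x∈X)

meets⇒⊆-merged : P ∈ₗ L → Nonempty (P ∩ X) → P ⊆ X ∪ ⋃ (hits X L)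
meets⇒⊆-merged {X = X} P∈L P∩X≢∅ x∈P = x∈p∪q⁺ (inj₂ (∈⋃⁺ (∈-filter⁺ (meets? X) P∈L P∩X≢∅) x∈P))

merge-isPartition : X ⊆ S → Nonempty X → IsPartition S L → IsPartition S (merge X L)
merge-isPartition {X = X} {S = S} {L = L} X⊆S (_ , x∈X) p@(nonempty , disjoint , _) = isPartition⁺
  ((_ , ⊆-merged {L = L} x∈X) ∷ AllP.filter⁺ (∁? (meets? X)) nonempty)
  (All.tabulate merged#misses ∷ AllPairsP.filter⁺ (∁? (meets? X)) disjoint)
  ⊆S cover
  where
  merged#misses : ∀ {B} → B ∈ₗ misses X L → Disjoint (X ∪ ⋃ (hits X L)) B
  merged#misses {B} B∈ with ∈-filter⁻ (∁? (meets? X)) {xs = L} B∈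
  ... | B∈L , B∩X≡∅ = disjoint⁺ λ x∈U x∈B → B∩X≡∅ (meets x∈U x∈B)
    where
    meets : x ∈ X ∪ ⋃ (hits X L) → x ∈ B → Nonempty (B ∩ X)
    meets {x} x∈U x∈B with x∈p∪q⁻ X _ x∈U
    ... | inj₁ x∈X  = nonempty-∩ x∈B x∈X
    ... | inj₂ x∈⋃ with ∈⋃⁻ (hits X L) x∈⋃
    ... | A , A∈hits , x∈A with ∈-filter⁻ (meets? X) {xs = L} A∈hits
    ... | A∈L , A∩X≢∅ = subst (λ C → Nonempty (C ∩ X)) (part-≡ p A∈L B∈L x∈A x∈B) A∩X≢∅
  ⊆S : ∀ {A} → A ∈ₗ merge X L → A ⊆ S
  ⊆S (here refl) x∈U with x∈p∪q⁻ X _ x∈U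
  ... | inj₁ x∈X  = X⊆S x∈X
  ... | inj₂ x∈⋃ with ∈⋃⁻ (hits X L) x∈⋃
  ... | A , A∈hits , x∈A = part⊆ p (proj₁ (∈-filter⁻ (meets? X) {xs = L} A∈hits)) x∈A
  ⊆S (there A∈) = part⊆ p (proj₁ (∈-filter⁻ (∁? (meets? X)) {xs = L} A∈))
  cover : ∀ {x} → x ∈ S → ∃[ A ] (A ∈ₗ merge X L × x ∈ A)
  cover x∈S with part-cover p x∈S
  ... | A , A∈L , x∈A with meets? X A
  ... | yes A∩X≢∅ = _ , here refl , meets⇒⊆-merged A∈L A∩X≢∅ x∈A
  ... | no A∩X≡∅  = A , there (∈-filter⁺ (∁? (meets? X)) A∈L A∩X≡∅) , x∈A

refine-isPartition : IsPartition T Q → X ∈ₗ Q → IsPartition X L → IsPartition T (misses X Q ++ L)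
refine-isPartition {T = T} {Q = Q} {X = X} {L = L} q@(nonemptyQ , disjointQ , _) X∈Q l@(nonemptyL , disjointL , _) =
  isPartition⁺
    (AllP.++⁺ (AllP.filter⁺ (∁? (meets? X)) nonemptyQ) nonemptyL)
    (AllPairsP.++⁺ (AllPairsP.filter⁺ (∁? (meets? X)) disjointQ) disjointL
                   (All.tabulate λ B∈ → All.tabulate λ C∈ → misses#L B∈ C∈))
    ⊆T cover
  where
  misses#L : ∀ {B C} → B ∈ₗ misses X Q → C ∈ₗ L → Disjoint B C
  misses#L B∈ C∈ = disjoint⁺ λ x∈B x∈C →
    proj₂ (∈-filter⁻ (∁? (meets? X)) {xs = Q} B∈) (nonempty-∩ x∈B (part⊆ l C∈ x∈C))
  ⊆T : ∀ {A} → A ∈ₗ misses X Q ++ L → A ⊆ T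
  ⊆T A∈ with ∈-++⁻ (misses X Q) A∈
  ... | inj₁ A∈misses = part⊆ q (proj₁ (∈-filter⁻ (∁? (meets? X)) {xs = Q} A∈misses))
  ... | inj₂ A∈L      = λ x∈A → part⊆ q X∈Q (part⊆ l A∈L x∈A)
  cover : ∀ {x} → x ∈ T → ∃[ A ] (A ∈ₗ misses X Q ++ L × x ∈ A)
  cover x∈T with part-cover q x∈T
  ... | A , A∈Q , x∈A with meets? X A
  ... | no A∩X≡∅ = A , ∈-++⁺ˡ (∈-filter⁺ (∁? (meets? X)) A∈Q A∩X≡∅) , x∈A
  ... | yes (_ , y∈A∩X) with part-≡ q A∈Q X∈Q (p∩q⊆p A X y∈A∩X) (p∩q⊆q A X y∈A∩X)
  ... | refl = let (C , C∈L , x∈C) = part-cover l x∈A in C , ∈-++⁺ʳ (misses X Q) C∈L , x∈C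

-- If every part of L meets S', the parts of L are told apart by their traces on S'.
⊆-part-of-trace : IsPartition S L → (∀ {P} → P ∈ₗ L → Nonempty (P ∩ S')) → X ⊆ S →
                  (∀ {P} → P ∈ₗ L → Nonempty (P ∩ X) → P ⊆ U) → R ∈ₗ L → U ∩ S' ⊆ R → X ⊆ R
⊆-part-of-trace {S' = S'} p meetsS' X⊆S ⊆U R∈L U∩S'⊆R x∈X with part-cover p (X⊆S x∈X)
... | P , P∈L , x∈P =
  let (_ , y∈P∩S') = meetsS' P∈L
      y∈P          = p∩q⊆p P S' y∈P∩S'
      y∈R          = U∩S'⊆R (x∈p∩q⁺ (⊆U P∈L (nonempty-∩ x∈P x∈X) y∈P , p∩q⊆q P S' y∈P∩S'))
  in subst (_ ∈_) (part-≡ p P∈L R∈L y∈P y∈R) x∈P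

optimal⁺ : (M : Matroid n) → IsPartition S L → (∀ Q → IsPartition S Q → r̃ M L ≤ r̃ M Q) → Optimal M S L
optimal⁺ M p minimal = p , (_ , p , refl) , minimal

≤r'⇒optimal : (M : Matroid n) {k : ℕ} → IsR' M S k → IsPartition S L → r̃ M L ≤ k → Optimal M S L
≤r'⇒optimal M (_ , minimal) p r̃L≤k = optimal⁺ M p λ Q pQ → ≤-trans r̃L≤k (minimal Q pQ)

module LooplessMatroid {n} (M : Matroid n) (loopless : Loopless M) where
  open Matroid M

  w : Subset n → ℕ
  w P = 2 * r P ∸ 1

  r-Empty : Empty A → r A ≡ 0
  r-Empty {A} A≡∅ = n≤0⇒n≡0 (subst (r A ≤_) (trans (cong ∣_∣ (Empty-unique A≡∅)) (∣⊥∣≡0 n)) (r-bounded A))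

  r-Nonempty : Nonempty A → 1 ≤ r A
  r-Nonempty {A} (x , x∈A) =
    subst (_≤ r A) (loopless x) (r-monotone λ y∈⁅x⁆ → subst (_∈ A) (sym (x∈⁅y⁆⇒x≡y x y∈⁅x⁆)) x∈A)

  1≤r⇒Nonempty : 1 ≤ r A → Nonempty A
  1≤r⇒Nonempty {A} 1≤rA with nonempty? A
  ... | yes A≢∅ = A≢∅
  ... | no  A≡∅ = contradiction (sym (r-Empty A≡∅)) (<⇒≢ 1≤rA)

  w-Empty : Empty A → w A ≡ 0
  w-Empty A≡∅ = cong (λ k → 2 * k ∸ 1) (r-Empty A≡∅)

  w-mono : A ⊆ B → w A ≤ w B
  w-mono A⊆B = ∸-monoˡ-≤ 1 (*-monoʳ-≤ 2 (r-monotone A⊆B))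

  suc-w : 1 ≤ r A → suc (w A) ≡ 2 * r A
  suc-w {A} 1≤rA = m+[n∸m]≡n (≤-trans 1≤rA (m≤n*m (r A) 2))

  w-positive : 1 ≤ r A → 1 ≤ w A
  w-positive {A} 1≤rA = s≤s⁻¹ (subst (2 ≤_) (sym (suc-w 1≤rA)) (*-monoʳ-≤ 2 1≤rA))

  w-injective : 1 ≤ r B → w A ≡ w B → r A ≡ r B
  w-injective {B} {A} 1≤rB wA≡wB = *-cancelˡ-≡ _ _ 2 (begin
    2 * r A     ≡⟨ suc-w 1≤rA ⟨
    suc (w A)   ≡⟨ cong suc wA≡wB ⟩
    suc (w B)   ≡⟨ suc-w 1≤rB ⟩
    2 * r B     ∎)
    where
    open ≡-Reasoning
    1≤rA : 1 ≤ r A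
    1≤rA = n≢0⇒n>0 λ rA≡0 → <⇒≢ (subst (1 ≤_) (sym wA≡wB) (w-positive 1≤rB)) (sym (cong (λ k → 2 * k ∸ 1) rA≡0))

  w-submod : Nonempty (A ∩ B) → w (A ∪ B) + w (A ∩ B) ≤ w A + w B
  w-submod {A} {B} (x , x∈A∩B) = +-cancelˡ-≤ 2 _ _ (begin
    2 + (w (A ∪ B) + w (A ∩ B))       ≡⟨ cong suc (+-suc _ _) ⟨
    suc (w (A ∪ B)) + suc (w (A ∩ B)) ≡⟨ cong₂ _+_ (suc-w (r-Nonempty A∪B≢∅)) (suc-w (r-Nonempty (x , x∈A∩B))) ⟩
    2 * r (A ∪ B) + 2 * r (A ∩ B)     ≡⟨ *-distribˡ-+ 2 (r (A ∪ B)) _ ⟨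
    2 * (r (A ∪ B) + r (A ∩ B))       ≤⟨ *-monoʳ-≤ 2 (r-submod A B) ⟩
    2 * (r A + r B)                   ≡⟨ *-distribˡ-+ 2 (r A) _ ⟩
    2 * r A + 2 * r B                 ≡⟨ cong₂ _+_ (suc-w (r-Nonempty (x , x∈A))) (suc-w (r-Nonempty (x , x∈B))) ⟨
    suc (w A) + suc (w B)             ≡⟨ cong suc (+-suc _ _) ⟩
    2 + (w A + w B)                   ∎)
    where
    open ≤-Reasoning
    x∈A = p∩q⊆p A B x∈A∩B
    x∈B = p∩q⊆q A B x∈A∩B
    A∪B≢∅ : Nonempty (A ∪ B)
    A∪B≢∅ = x , x∈p∪q⁺ (inj₁ x∈A)

  r̃-++ : ∀ L Q → r̃ M (L ++ Q) ≡ r̃ M L + r̃ M Q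
  r̃-++ L Q = trans (cong sum (map-++ w L Q)) (sum-++ (map w L) (map w Q))

  r̃-split : ∀ X L → r̃ M L ≡ r̃ M (hits X L) + r̃ M (misses X L)
  r̃-split X = sum-map-filter-split (meets? X) w

  -- Truncated subtraction gives w A = 0 for empty A, so the empty traces that restrict drops contribute nothing.
  r̃-restrict : ∀ X L → r̃ M (restrict X L) ≡ sum (map (λ P → w (P ∩ X)) L)
  r̃-restrict X L = trans (cong sum (sym (map-∘ (hits X L)))) (sum-map-filter (meets? X) w-Empty L)

  r̃-restrict-≤ : ∀ X L → r̃ M (restrict X L) ≤ r̃ M L
  r̃-restrict-≤ X L =
    ≤-trans (≤-reflexive (r̃-restrict X L)) (sum-map-mono-≤ (λ P → w-mono (p∩q⊆p P X)) L)

  r̃-restrict-rigid : All Nonempty L → r̃ M L ≤ r̃ M (restrict X L) → All (λ P → r (P ∩ X) ≡ r P) L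
  r̃-restrict-rigid {L = L} {X = X} nonempty r̃L≤ =
    All.zipWith (λ (P≢∅ , w≡) → w-injective (r-Nonempty P≢∅) w≡)
      (nonempty , sum-map-mono-≤-rigid (λ P → w-mono (p∩q⊆p P X)) L
                    (≤-trans r̃L≤ (≤-reflexive (r̃-restrict X L))))

  r̃-restrict-≡ : All (λ P → r (P ∩ X) ≡ r P) L → r̃ M (restrict X L) ≡ r̃ M L
  r̃-restrict-≡ {X = X} {L = L} ranks =
    trans (r̃-restrict X L) (cong sum (map-cong-local (All.map (cong (λ k → 2 * k ∸ 1)) ranks)))

  w-merge-≤ : ∀ H → All (λ P → Nonempty (P ∩ X)) H → w (X ∪ ⋃ H) + r̃ M (map (_∩ X) H) ≤ w X + r̃ M H
  w-merge-≤ {X = X} [] [] = ≤-reflexive (cong (λ Z → w Z + 0) (∪-identityʳ X))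
  w-merge-≤ {X = X} (P ∷ H) (P∩X≢∅ ∷ H-meets) = begin
    w (X ∪ (P ∪ ⋃ H)) + (w (P ∩ X) + Σ) ≡⟨ cong (λ Z → w Z + (w (P ∩ X) + Σ)) reassociate ⟩
    w (Y ∪ P) + (w (P ∩ X) + Σ)         ≤⟨ +-monoʳ-≤ (w (Y ∪ P)) (+-monoˡ-≤ Σ (w-mono P∩X⊆Y∩P)) ⟩
    w (Y ∪ P) + (w (Y ∩ P) + Σ)         ≡⟨ +-assoc (w (Y ∪ P)) _ _ ⟨
    (w (Y ∪ P) + w (Y ∩ P)) + Σ         ≤⟨ +-monoˡ-≤ Σ (w-submod (nonempty-⊆ P∩X⊆Y∩P P∩X≢∅)) ⟩
    (w Y + w P) + Σ                     ≡⟨ xy∙z≈y∙xz (w Y) (w P) Σ ⟩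
    w P + (w Y + Σ)                     ≤⟨ +-monoʳ-≤ (w P) (w-merge-≤ H H-meets) ⟩
    w P + (w X + r̃ M H)                 ≡⟨ x∙yz≈y∙xz (w P) (w X) _ ⟩
    w X + (w P + r̃ M H)                 ∎
    where
    open ≤-Reasoning
    Y = X ∪ ⋃ H
    Σ = r̃ M (map (_∩ X) H)
    reassociate : X ∪ (P ∪ ⋃ H) ≡ Y ∪ P
    reassociate = trans (cong (X ∪_) (∪-comm P (⋃ H))) (sym (∪-assoc X (⋃ H) P))
    P∩X⊆Y∩P : P ∩ X ⊆ Y ∩ P
    P∩X⊆Y∩P x∈P∩X = x∈p∩q⁺ (x∈p∪q⁺ (inj₁ (p∩q⊆q P X x∈P∩X)) , p∩q⊆p P X x∈P∩X)

  r̃-uncross : X ∈ₗ Q → Nonempty X →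
              r̃ M (merge X 𝐏) + r̃ M (misses X Q ++ restrict X 𝐏) ≤ r̃ M 𝐏 + r̃ M Q
  r̃-uncross {X = X} {Q = Q} {𝐏 = 𝐏} X∈Q (_ , x∈X) = begin
    (w merged + r̃ M N) + r̃ M (missesQ ++ restrict X 𝐏)
      ≡⟨ cong (w merged + r̃ M N +_) (r̃-++ missesQ (restrict X 𝐏)) ⟩
    (w merged + r̃ M N) + (r̃ M missesQ + r̃ M (restrict X 𝐏))
      ≡⟨ rearrange₁ (w merged) (r̃ M N) _ _ ⟩
    (w merged + r̃ M (restrict X 𝐏)) + (r̃ M N + r̃ M missesQ)
      ≤⟨ +-monoˡ-≤ _ (w-merge-≤ (hits X 𝐏) (AllP.all-filter (meets? X) 𝐏)) ⟩
    (w X + r̃ M (hits X 𝐏)) + (r̃ M N + r̃ M missesQ)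
      ≡⟨ rearrange₂ (w X) (r̃ M (hits X 𝐏)) _ _ ⟩
    (r̃ M (hits X 𝐏) + r̃ M N) + (w X + r̃ M missesQ)
      ≤⟨ +-mono-≤ (≤-reflexive (sym (r̃-split X 𝐏))) (+-monoˡ-≤ _ (∈⇒≤sum-map w X∈hits)) ⟩
    r̃ M 𝐏 + (r̃ M (hits X Q) + r̃ M missesQ)
      ≡⟨ cong (r̃ M 𝐏 +_) (r̃-split X Q) ⟨
    r̃ M 𝐏 + r̃ M Q ∎
    where
    open ≤-Reasoning
    merged = X ∪ ⋃ (hits X 𝐏)
    N = misses X 𝐏
    missesQ = misses X Q
    X∈hits : X ∈ₗ hits X Q
    X∈hits = ∈-filter⁺ (meets? X) X∈Q (nonempty-∩ x∈X x∈X)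
    rearrange₁ : ∀ a b c d → (a + b) + (c + d) ≡ (a + d) + (b + c)
    rearrange₁ = solve-∀
    rearrange₂ : ∀ a b c d → (a + b) + (c + d) ≡ (b + c) + (a + d)
    rearrange₂ = solve-∀

  merge-optimal : T ⊆ S → Optimal M S 𝐏 → Optimal M T Q → X ∈ₗ Q → Optimal M S (merge X 𝐏)
  merge-optimal {T = T} {S = S} {𝐏 = 𝐏} {Q = Q} {X = X} T⊆S (p𝐏 , r'S) (pQ , r'T) X∈Q =
    ≤r'⇒optimal M r'S pW (+-cancelʳ-≤ (r̃ M Q) _ _ (begin
      r̃ M W + r̃ M Q   ≤⟨ +-monoʳ-≤ (r̃ M W) (proj₂ r'T W₂ pW₂) ⟩
      r̃ M W + r̃ M W₂  ≤⟨ r̃-uncross {𝐏 = 𝐏} X∈Q X≢∅ ⟩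
      r̃ M 𝐏 + r̃ M Q   ∎))
    where
    open ≤-Reasoning
    X⊆S : X ⊆ S
    X⊆S x∈X = T⊆S (part⊆ pQ X∈Q x∈X)
    X≢∅ = All.lookup (proj₁ pQ) X∈Q
    W = merge X 𝐏
    W₂ = misses X Q ++ restrict X 𝐏
    pW = merge-isPartition X⊆S X≢∅ p𝐏
    pW₂ = refine-isPartition pQ X∈Q (restrict-isPartition X⊆S p𝐏)

  module Meet {S' S : Subset n} {𝐏' 𝐏 : Family n} (S'⊆S : S' ⊆ S)
              (p𝐏' : IsPartition S' 𝐏') (p𝐏 : IsPartition S 𝐏) (meet : IsMeet 𝐏 S' 𝐏') where

    RanksPreserved : Set
    RanksPreserved = ∀ {P} → P ∈ₗ 𝐏 → r (P ∩ S') ≡ r P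

    Tight : Set
    Tight = Optimal M S 𝐏 × IsR' M S' (r̃ M 𝐏)

    p𝐏∧S' : IsPartition S' (restrict S' 𝐏)
    p𝐏∧S' = restrict-isPartition S'⊆S p𝐏

    r̃𝐏'≡r̃𝐏∧S' : r̃ M 𝐏' ≡ r̃ M (restrict S' 𝐏)
    r̃𝐏'≡r̃𝐏∧S' = sum-↭ (↭.map⁺ w (meets-partition⇒↭ p𝐏' p𝐏∧S' meet (restrict-isMeet S' 𝐏)))

    tight⇒ : Tight → RanksPreserved × Optimal M S' 𝐏'
    tight⇒ (_ , r'S') =
      All.lookup (r̃-restrict-rigid (proj₁ p𝐏) r̃𝐏≤) , p𝐏' , subst (IsR' M S') r̃𝐏≡r̃𝐏' r'S'
      where
      r̃𝐏≤ : r̃ M 𝐏 ≤ r̃ M (restrict S' 𝐏)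
      r̃𝐏≤ = proj₂ r'S' _ p𝐏∧S'
      r̃𝐏≡r̃𝐏' : r̃ M 𝐏 ≡ r̃ M 𝐏'
      r̃𝐏≡r̃𝐏' = trans (≤-antisym r̃𝐏≤ (r̃-restrict-≤ S' 𝐏)) (sym r̃𝐏'≡r̃𝐏∧S')

    tight⇐ : RanksPreserved × Optimal M S' 𝐏' → Tight
    tight⇐ (ranks , _ , r'S') = optimal⁺ M p𝐏 minimal , subst (IsR' M S') r̃𝐏'≡r̃𝐏 r'S'
      where
      r̃𝐏'≡r̃𝐏 : r̃ M 𝐏' ≡ r̃ M 𝐏
      r̃𝐏'≡r̃𝐏 = trans r̃𝐏'≡r̃𝐏∧S' (r̃-restrict-≡ (All.tabulate ranks))
      minimal : ∀ Q → IsPartition S Q → r̃ M 𝐏 ≤ r̃ M Q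
      minimal Q pQ = begin
        r̃ M 𝐏                ≡⟨ r̃𝐏'≡r̃𝐏 ⟨
        r̃ M 𝐏'               ≤⟨ proj₂ r'S' _ (restrict-isPartition S'⊆S pQ) ⟩
        r̃ M (restrict S' Q)  ≤⟨ r̃-restrict-≤ S' Q ⟩
        r̃ M Q                ∎
        where open ≤-Reasoning

    coarsest⇒ : Tight → CoarsestOptimal M S 𝐏 → CoarsestOptimal M S' 𝐏'
    coarsest⇒ tight (opt𝐏 , coarsest) = proj₂ (tight⇒ tight) , refines
      where
      refines : ∀ Q → Optimal M S' Q → Refines Q 𝐏'
      refines Q optQ {X} X∈Q with coarsest _ (merge-optimal S'⊆S opt𝐏 optQ X∈Q) (here refl)
      ... | R , R∈𝐏 , merged⊆R =
        R ∩ S' , proj₂ meet R∈𝐏 (nonempty-⊆ X⊆R∩S' (All.lookup (proj₁ (proj₁ optQ)) X∈Q)) , X⊆R∩S'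
        where
        X⊆R∩S' : X ⊆ R ∩ S'
        X⊆R∩S' x∈X = x∈p∩q⁺ (merged⊆R (⊆-merged {L = 𝐏} x∈X) , part⊆ (proj₁ optQ) X∈Q x∈X)

    coarsest⇐ : Tight → CoarsestOptimal M S' 𝐏' → CoarsestOptimal M S 𝐏
    coarsest⇐ tight@(opt𝐏 , r'S') (_ , coarsest') = opt𝐏 , refines
      where
      meetsS' : ∀ {P} → P ∈ₗ 𝐏 → Nonempty (P ∩ S')
      meetsS' P∈𝐏 = 1≤r⇒Nonempty
        (subst (1 ≤_) (sym (proj₁ (tight⇒ tight) P∈𝐏)) (r-Nonempty (All.lookup (proj₁ p𝐏) P∈𝐏)))
      refines : ∀ Q → Optimal M S Q → Refines Q 𝐏
      refines Q optQ {X} X∈Q with coarsest' _ optW∧S' (proj₂ (restrict-isMeet S' W) (here refl) merged∩S'≢∅)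
        where
        W = merge X 𝐏
        optW = merge-optimal (λ x∈S → x∈S) opt𝐏 optQ X∈Q
        optW∧S' : Optimal M S' (restrict S' W)
        optW∧S' = ≤r'⇒optimal M r'S' (restrict-isPartition S'⊆S (proj₁ optW))
                                     (≤-trans (r̃-restrict-≤ S' W) (proj₂ (proj₂ optW) 𝐏 p𝐏))
        merged∩S'≢∅ : Nonempty ((X ∪ ⋃ (hits X 𝐏)) ∩ S')
        merged∩S'≢∅ with All.lookup (proj₁ (proj₁ optQ)) X∈Q
        ... | x , x∈X with part-cover p𝐏 (part⊆ (proj₁ optQ) X∈Q x∈X)
        ... | P , P∈𝐏 , x∈P = nonempty-⊆ P∩S'⊆merged∩S' (meetsS' P∈𝐏)
          where
          P∩S'⊆merged∩S' : P ∩ S' ⊆ (X ∪ ⋃ (hits X 𝐏)) ∩ S'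
          P∩S'⊆merged∩S' y∈P∩S' =
            x∈p∩q⁺ (meets⇒⊆-merged P∈𝐏 (nonempty-∩ x∈P x∈X) (p∩q⊆p P S' y∈P∩S') , p∩q⊆q P S' y∈P∩S')
      ... | Y , Y∈𝐏' , merged∩S'⊆Y with proj₁ meet Y∈𝐏'
      ... | R , R∈𝐏 , refl , _ =
        R , R∈𝐏 , ⊆-part-of-trace p𝐏 meetsS' (part⊆ (proj₁ optQ) X∈Q) meets⇒⊆-merged R∈𝐏
                    (λ x∈merged∩S' → p∩q⊆p R S' (merged∩S'⊆Y x∈merged∩S'))

lemma4p3 : ∀ {n} (M : Matroid n) → Loopless M →
    (S' S : Subset n) → S' ⊆ S →
    (𝐏' 𝐏 : Family n) → IsPartition S' 𝐏' → IsPartition S 𝐏 →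
    IsMeet 𝐏 S' 𝐏' →
    ((Optimal M S 𝐏 × IsR' M S' (r̃ M 𝐏))
      ⇔ ((∀ {P} → P ∈ₗ 𝐏 → Matroid.r M (P ∩ S') ≡ Matroid.r M P) × Optimal M S' 𝐏'))
    × ((Optimal M S 𝐏 × IsR' M S' (r̃ M 𝐏))
      → (CoarsestOptimal M S 𝐏 ⇔ CoarsestOptimal M S' 𝐏'))
lemma4p3 M loopless S' S S'⊆S 𝐏' 𝐏 p𝐏' p𝐏 meet =
  mk⇔ tight⇒ tight⇐ , λ tight → mk⇔ (coarsest⇒ tight) (coarsest⇐ tight)
  where open LooplessMatroid.Meet M loopless S'⊆S p𝐏' p𝐏 meet
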